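{- Let $s$ be a fully normalized binary string of length $n\ge 5$. Then $d_{pbi}^g(s)=\left\lceil \frac{n-2}{3}\right\rceil$.
   Context: A binary string is $s=s[1]\ldots s[n]$ with each $s[i]\in\{0,1\}$. A string is normalized if no two adjacent symbols are equal; normalizing means replacing every maximal run of identical adjacent symbols by a single copy. A fully normalized binary string is a normalized string over $\{0,1\}$ in which both $0$ and $1$ occur. For $1\le x<y\le z\le n$, the prefix block-interchange $\beta(1,x,y,z)$ transforms $s$ into $s[y]\ldots s[z]\,s[x+1]\ldots s[y-1]\,s[1]\ldots s[x]\,s[z+1]\ldots s[n]$. A string is grouped if its normalized form contains each of its symbols exactly once (all identical symbols are contiguous). The grouping distance $d_{pbi}^g(s)$ is the minimum number of prefix block-interchanges (each followed by normalization) needed to transform $s$ into a grouped string. -}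

module Defs where

open import Data.Bool using (Bool; true; false)
open import Data.Bool.Properties using () renaming (_≟_ to _≟ᵇ_)
open import Data.Nat using (ℕ; zero; suc; _≤_)
open import Data.List using (List; []; _∷_; _++_; derun)
open import Data.List.Membership.Propositional using (_∈_)
open import Data.List.Relation.Unary.Linked using (Linked)
open import Data.List.Relation.Unary.Unique.Propositional using (Unique)
open import Data.Product using (Σ; _×_; ∃; ∃-syntax)
open import Relation.Binary.PropositionalEquality using (_≡_; _≢_)

BinString : Set
BinString = List Bool

normalize : BinString → BinString
normalize = derun _≟ᵇ_

Normalized : BinString → Set
Normalized = Linked _≢_

FullyNormalized : BinString → Set
FullyNormalized s = Normalized s × false ∈ s × true ∈ s

Grouped : BinString → Set
Grouped s = Unique (normalize s)

-- One prefix block-interchange β(1,x,y,z) followed by normalization.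
-- Writing s = A ++ B ++ C ++ D with A = s[1..x], B = s[x+1..y-1],
-- C = s[y..z], D = s[z+1..n]; the constraints 1 ≤ x < y ≤ z ≤ n say
-- exactly that A and C are nonempty (B and D may be empty).
PBIStep : BinString → BinString → Set
PBIStep s t =
  Σ BinString λ A → Σ BinString λ B → Σ BinString λ C → Σ BinString λ D →
    A ≢ [] × C ≢ [] × s ≡ A ++ B ++ C ++ D × t ≡ normalize (C ++ B ++ A ++ D)

data Reach : ℕ → BinString → BinString → Set where
  done : ∀ {s} → Reach zero s s
  step : ∀ {k s t u} → PBIStep s t → Reach k t u → Reach (suc k) s u

GroupingDistance : BinString → ℕ → Set
GroupingDistance s m =
  (∃[ t ] (Reach m s t × Grouped t)) ×
  (∀ k t → Reach k s t → Grouped t → m ≤ k)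

-- ⌈ a / b ⌉ for b = suc d
ceilDiv : ℕ → ℕ → ℕ
ceilDiv a zero = zero
ceilDiv a (suc d) = Data.Nat._/_ (a Data.Nat.+ d) (suc d)

-- The proof counts blocks (maximal runs of equal symbols).
--  * Lower bound.  A prefix block-interchange cuts s = A B C D at three
--    places and glues C B A D at three places; cutting creates no blocks and
--    each gluing merges at most two, so one step (followed by normalization,
--    which preserves the block count) lowers the block count by at most 3.
--    A grouped binary string has at most 2 blocks, hence k steps can only
--    group s if blocks s ≤ 2 + 3k, i.e. k ≥ ⌈(blocks s - 2) / 3⌉.
--  * Upper bound.  A normalized string of length n is the alternating
--    string of length n starting with its first symbol.  One well-chosen
--    step turns an alternating string of length m + 6 into one of length
--    m + 3, and one step groups alternating strings of length 3, 4 and 5;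
--    strings of length ≤ 2 are grouped already.
--  * For a normalized s the block count is its length, so both bounds agree.
module Submission where

open import Defs
open import Data.Bool using (Bool; true; false; not)
open import Data.Bool.Properties using (not-¬) renaming (_≟_ to _≟ᵇ_)
open import Data.Nat using (ℕ; zero; suc; _+_; _*_; _∸_; _/_; _≤_; z≤n; s≤s)
open import Data.Nat.Properties
open import Data.Nat.DivMod using (m<n*o⇒m/o<n; n/n≡1; +-distrib-/-∣ˡ)
open import Data.Nat.Divisibility using (∣-refl)
open import Data.List using (List; []; _∷_; _++_; length)
open import Data.List.Properties using (derun-accept)
open import Data.List.Relation.Unary.Linked using ([]; [-]; _∷_)
open import Data.List.Relation.Unary.AllPairs using ([]; _∷_)
open import Data.List.Relation.Unary.All using ([]; _∷_)
open import Data.List.Relation.Unary.Unique.Propositional using (Unique)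
open import Data.Product using (_,_; ∃-syntax; _×_)
open import Data.Empty using (⊥; ⊥-elim)
open import Data.Nat.Solver using (module +-*-Solver)
open import Relation.Binary.PropositionalEquality
  using (_≡_; _≢_; refl; sym; trans; cong; subst; module ≡-Reasoning)

boundary : Bool → Bool → ℕ
boundary true  true  = 0
boundary true  false = 1
boundary false true  = 1
boundary false false = 0

boundary≤1 : ∀ x y → boundary x y ≤ 1
boundary≤1 true  true  = z≤n
boundary≤1 true  false = s≤s z≤n
boundary≤1 false true  = s≤s z≤n
boundary≤1 false false = z≤n

blocks : BinString → ℕ
blocks []          = 0
blocks (x ∷ [])    = 1
blocks (x ∷ y ∷ r) = boundary x y + blocks (y ∷ r)

length-normalize : ∀ s → length (normalize s) ≡ blocks s
length-normalize []                 = refl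
length-normalize (x ∷ [])           = refl
length-normalize (true ∷ true ∷ r)   = length-normalize (true ∷ r)
length-normalize (true ∷ false ∷ r)  = cong suc (length-normalize (false ∷ r))
length-normalize (false ∷ true ∷ r)  = cong suc (length-normalize (true ∷ r))
length-normalize (false ∷ false ∷ r) = length-normalize (false ∷ r)

blocks-normalized : ∀ s → Normalized s → blocks s ≡ length s
blocks-normalized []                 _       = refl
blocks-normalized (x ∷ [])           _       = refl
blocks-normalized (true ∷ true ∷ r)   (p ∷ _) = ⊥-elim (p refl)
blocks-normalized (true ∷ false ∷ r)  (_ ∷ l) = cong suc (blocks-normalized _ l)
blocks-normalized (false ∷ true ∷ r)  (_ ∷ l) = cong suc (blocks-normalized _ l)
blocks-normalized (false ∷ false ∷ r) (p ∷ _) = ⊥-elim (p refl)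

normalize-head : ∀ y r → ∃[ zs ] normalize (y ∷ r) ≡ y ∷ zs
normalize-head y             []      = [] , refl
normalize-head true  (true ∷ r)  = normalize-head true r
normalize-head true  (false ∷ r) = _ , refl
normalize-head false (true ∷ r)  = _ , refl
normalize-head false (false ∷ r) = normalize-head false r

prepend-normalized : ∀ {x y} r → x ≢ y →
  Normalized (normalize (y ∷ r)) → Normalized (x ∷ normalize (y ∷ r))
prepend-normalized {y = y} r x≢y n with normalize (y ∷ r) | normalize-head y r
... | _ | _ , refl = x≢y ∷ n

normalize-normalized : ∀ s → Normalized (normalize s)
normalize-normalized []                  = []
normalize-normalized (x ∷ [])            = [-]
normalize-normalized (true ∷ true ∷ r)   = normalize-normalized (true ∷ r)
normalize-normalized (true ∷ false ∷ r)  =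
  prepend-normalized r (λ ()) (normalize-normalized (false ∷ r))
normalize-normalized (false ∷ true ∷ r)  =
  prepend-normalized r (λ ()) (normalize-normalized (true ∷ r))
normalize-normalized (false ∷ false ∷ r) = normalize-normalized (false ∷ r)

blocks-normalize : ∀ s → blocks (normalize s) ≡ blocks s
blocks-normalize s = begin
  blocks (normalize s) ≡⟨ blocks-normalized _ (normalize-normalized s) ⟩
  length (normalize s) ≡⟨ length-normalize s ⟩
  blocks s             ∎
  where open ≡-Reasoning

blocks-cons-≤ : ∀ x Y → blocks (x ∷ Y) ≤ suc (blocks Y)
blocks-cons-≤ x []      = ≤-refl
blocks-cons-≤ x (y ∷ r) = +-monoˡ-≤ (blocks (y ∷ r)) (boundary≤1 x y)

blocks-cons-≥ : ∀ x Y → blocks Y ≤ blocks (x ∷ Y)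
blocks-cons-≥ x []      = z≤n
blocks-cons-≥ x (y ∷ r) = m≤n+m (blocks (y ∷ r)) (boundary x y)

blocks-++-≤ : ∀ X Y → blocks (X ++ Y) ≤ blocks X + blocks Y
blocks-++-≤ []          Y = ≤-refl
blocks-++-≤ (x ∷ [])    Y = blocks-cons-≤ x Y
blocks-++-≤ (x ∷ y ∷ r) Y = begin
  boundary x y + blocks (y ∷ r ++ Y)          ≤⟨ +-monoʳ-≤ (boundary x y) (blocks-++-≤ (y ∷ r) Y) ⟩
  boundary x y + (blocks (y ∷ r) + blocks Y)  ≡⟨ +-assoc (boundary x y) _ _ ⟨
  blocks (x ∷ y ∷ r) + blocks Y               ∎
  where open ≤-Reasoning

blocks-++-≥ : ∀ X Y → blocks X + blocks Y ≤ suc (blocks (X ++ Y))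
blocks-++-≥ []          Y = n≤1+n (blocks Y)
blocks-++-≥ (x ∷ [])    Y = s≤s (blocks-cons-≥ x Y)
blocks-++-≥ (x ∷ y ∷ r) Y = begin
  blocks (x ∷ y ∷ r) + blocks Y               ≡⟨ +-assoc (boundary x y) _ _ ⟩
  boundary x y + (blocks (y ∷ r) + blocks Y)  ≤⟨ +-monoʳ-≤ (boundary x y) (blocks-++-≥ (y ∷ r) Y) ⟩
  boundary x y + suc (blocks (y ∷ r ++ Y))    ≡⟨ +-suc (boundary x y) _ ⟩
  suc (blocks (x ∷ y ∷ r ++ Y))               ∎
  where open ≤-Reasoning

blocks-glue₄ : ∀ X Y Z W →
  blocks X + (blocks Y + (blocks Z + blocks W)) ≤ 3 + blocks (X ++ Y ++ Z ++ W)
blocks-glue₄ X Y Z W = begin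
  x + (y + (z + w))              ≤⟨ +-monoʳ-≤ x (+-monoʳ-≤ y (blocks-++-≥ Z W)) ⟩
  x + (y + suc (blocks (Z ++ W))) ≡⟨ cong (x +_) (+-suc y _) ⟩
  x + suc (y + blocks (Z ++ W))   ≤⟨ +-monoʳ-≤ x (s≤s (blocks-++-≥ Y (Z ++ W))) ⟩
  x + suc (suc (blocks YZW))      ≡⟨ trans (+-suc x _) (cong suc (+-suc x _)) ⟩
  2 + (x + blocks YZW)            ≤⟨ s≤s (s≤s (blocks-++-≥ X YZW)) ⟩
  3 + blocks (X ++ YZW)           ∎
  where
  open ≤-Reasoning
  x = blocks X
  y = blocks Y
  z = blocks Z
  w = blocks W
  YZW = Y ++ Z ++ W

blocks-PBIStep : ∀ {s t} → PBIStep s t → blocks s ≤ 3 + blocks t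
blocks-PBIStep (A , B , C , D , _ , _ , refl , refl) = begin
  blocks (A ++ B ++ C ++ D)            ≤⟨ cut ⟩
  a + (b + (c + d))                    ≡⟨ reorder a b c d ⟩
  c + (b + (a + d))                    ≤⟨ blocks-glue₄ C B A D ⟩
  3 + blocks (C ++ B ++ A ++ D)        ≡⟨ cong (3 +_) (blocks-normalize (C ++ B ++ A ++ D)) ⟨
  3 + blocks (normalize (C ++ B ++ A ++ D)) ∎
  where
  open ≤-Reasoning
  open +-*-Solver
  a = blocks A
  b = blocks B
  c = blocks C
  d = blocks D
  cut : blocks (A ++ B ++ C ++ D) ≤ a + (b + (c + d))
  cut = ≤-trans (blocks-++-≤ A _) (+-monoʳ-≤ a
          (≤-trans (blocks-++-≤ B _) (+-monoʳ-≤ b (blocks-++-≤ C D))))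
  reorder : ∀ a b c d → a + (b + (c + d)) ≡ c + (b + (a + d))
  reorder = solve 4 (λ a b c d → a :+ (b :+ (c :+ d)) := c :+ (b :+ (a :+ d))) refl

no-three-distinct : ∀ (x y z : Bool) → x ≢ y → x ≢ z → y ≢ z → ⊥
no-three-distinct true  true  _     x≢y _   _   = x≢y refl
no-three-distinct false false _     x≢y _   _   = x≢y refl
no-three-distinct true  false true  _   x≢z _   = x≢z refl
no-three-distinct true  false false _   _   y≢z = y≢z refl
no-three-distinct false true  true  _   _   y≢z = y≢z refl
no-three-distinct false true  false _   x≢z _   = x≢z refl

unique-length≤2 : ∀ (xs : List Bool) → Unique xs → length xs ≤ 2
unique-length≤2 []          _ = z≤n
unique-length≤2 (x ∷ [])    _ = s≤s z≤n
unique-length≤2 (x ∷ y ∷ []) _ = ≤-refl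
unique-length≤2 (x ∷ y ∷ z ∷ _) ((x≢y ∷ x≢z ∷ _) ∷ (y≢z ∷ _) ∷ _) =
  ⊥-elim (no-three-distinct x y z x≢y x≢z y≢z)

blocks-grouped : ∀ t → Grouped t → blocks t ≤ 2
blocks-grouped t g = subst (_≤ 2) (length-normalize t) (unique-length≤2 _ g)

blocks-Reach : ∀ {k s t} → Reach k s t → Grouped t → blocks s ≤ 2 + k * 3
blocks-Reach {t = t} done       g = blocks-grouped t g
blocks-Reach         (step p r) g = ≤-trans (blocks-PBIStep p) (+-monoʳ-≤ 3 (blocks-Reach r g))

alt : Bool → ℕ → BinString
alt b zero    = []
alt b (suc n) = b ∷ alt (not b) n

normalized-alt : ∀ b r → Normalized (b ∷ r) → b ∷ r ≡ alt b (length (b ∷ r))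
normalized-alt b     []          _       = refl
normalized-alt true  (true ∷ r)  (p ∷ _) = ⊥-elim (p refl)
normalized-alt true  (false ∷ r) (_ ∷ l) = cong (true ∷_) (normalized-alt false r l)
normalized-alt false (true ∷ r)  (_ ∷ l) = cong (false ∷_) (normalized-alt true r l)
normalized-alt false (false ∷ r) (p ∷ _) = ⊥-elim (p refl)

normalize-alt : ∀ b n → normalize (alt b n) ≡ alt b n
normalize-alt b zero          = refl
normalize-alt b (suc zero)    = refl
normalize-alt b (suc (suc n)) = begin
  normalize (b ∷ not b ∷ alt (not (not b)) n)  ≡⟨ derun-accept _≟ᵇ_ (alt (not (not b)) n) (not-¬ refl) ⟩
  b ∷ normalize (alt (not b) (suc n))         ≡⟨ cong (b ∷_) (normalize-alt (not b) (suc n)) ⟩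
  alt b (suc (suc n))                         ∎
  where open ≡-Reasoning

alt-grouped : ∀ b n → n ≤ 2 → Grouped (alt b n)
alt-grouped b n n≤2 = subst Unique (sym (normalize-alt b n)) (unique n n≤2)
  where
  unique : ∀ n → n ≤ 2 → Unique (alt b n)
  unique zero                _                     = []
  unique (suc zero)          _                     = [] ∷ []
  unique (suc (suc zero))    _                     = (not-¬ refl ∷ []) ∷ [] ∷ []
  unique (suc (suc (suc n))) (s≤s (s≤s ()))

-- Cutting b¬b | b | ¬bb | ¬b… and swapping the first and third piece
-- merges blocks at all three seams: the alternating string shrinks by 3.
alt-step : ∀ b m → PBIStep (alt b (6 + m)) (alt (not b) (3 + m))
alt-step true m =
  (true ∷ false ∷ []) , (true ∷ []) , (false ∷ true ∷ []) , alt false (suc m) ,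
  (λ ()) , (λ ()) , refl , cong (λ l → false ∷ true ∷ l) (sym (normalize-alt false (suc m)))
alt-step false m =
  (false ∷ true ∷ []) , (false ∷ []) , (true ∷ false ∷ []) , alt true (suc m) ,
  (λ ()) , (λ ()) , refl , cong (λ l → true ∷ false ∷ l) (sym (normalize-alt true (suc m)))

alt-last-step : ∀ b j → j ≤ 2 → PBIStep (alt b (3 + j)) (alt (not b) 2)
alt-last-step true  0 _ =
  (true ∷ []) , [] , (false ∷ []) , (true ∷ []) , (λ ()) , (λ ()) , refl , refl
alt-last-step false 0 _ =
  (false ∷ []) , [] , (true ∷ []) , (false ∷ []) , (λ ()) , (λ ()) , refl , refl
alt-last-step true  1 _ =
  (true ∷ []) , (false ∷ true ∷ []) , (false ∷ []) , [] , (λ ()) , (λ ()) , refl , refl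
alt-last-step false 1 _ =
  (false ∷ []) , (true ∷ false ∷ []) , (true ∷ []) , [] , (λ ()) , (λ ()) , refl , refl
alt-last-step true  2 _ =
  (true ∷ []) , (false ∷ true ∷ []) , (false ∷ []) , (true ∷ []) , (λ ()) , (λ ()) , refl , refl
alt-last-step false 2 _ =
  (false ∷ []) , (true ∷ false ∷ []) , (true ∷ []) , (false ∷ []) , (λ ()) , (λ ()) , refl , refl
alt-last-step b (suc (suc (suc j))) (s≤s (s≤s ()))

ceilDiv-+ : ∀ d a → ceilDiv (suc d + a) (suc d) ≡ suc (ceilDiv a (suc d))
ceilDiv-+ d a = begin
  (suc d + a + d) / suc d               ≡⟨ cong (_/ suc d) (+-assoc (suc d) a d) ⟩
  (suc d + (a + d)) / suc d             ≡⟨ +-distrib-/-∣ˡ (a + d) ∣-refl ⟩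
  suc d / suc d + (a + d) / suc d       ≡⟨ cong (_+ (a + d) / suc d) (n/n≡1 (suc d)) ⟩
  suc ((a + d) / suc d)                 ∎
  where open ≡-Reasoning

ceilDiv-least : ∀ a d k → a ≤ k * suc d → ceilDiv a (suc d) ≤ k
ceilDiv-least a d k a≤ = ≤-pred (m<n*o⇒m/o<n (begin-strict
  a + d             ≤⟨ +-monoˡ-≤ d a≤ ⟩
  k * suc d + d     <⟨ +-monoʳ-< (k * suc d) (n<1+n d) ⟩
  k * suc d + suc d ≡⟨ +-comm (k * suc d) (suc d) ⟩
  suc k * suc d     ∎))
  where open ≤-Reasoning

alt-upper : ∀ b n → ∃[ t ] (Reach (ceilDiv (n ∸ 2) 3) (alt b n) t × Grouped t)
alt-upper b 0 = _ , done , alt-grouped b 0 z≤n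
alt-upper b 1 = _ , done , alt-grouped b 1 (s≤s z≤n)
alt-upper b 2 = _ , done , alt-grouped b 2 ≤-refl
alt-upper b 3 = _ , step (alt-last-step b 0 z≤n) done , alt-grouped (not b) 2 ≤-refl
alt-upper b 4 = _ , step (alt-last-step b 1 (s≤s z≤n)) done , alt-grouped (not b) 2 ≤-refl
alt-upper b 5 = _ , step (alt-last-step b 2 ≤-refl) done , alt-grouped (not b) 2 ≤-refl
alt-upper b (suc (suc (suc (suc (suc (suc m)))))) with alt-upper (not b) (3 + m)
... | t , r , g =
  t , subst (λ k → Reach k (alt b (6 + m)) t) (sym (ceilDiv-+ 2 (suc m))) (step (alt-step b m) r) , g

lemma2 : ∀ (s : BinString) → FullyNormalized s → 5 ≤ length s →
    GroupingDistance s (ceilDiv (length s ∸ 2) 3)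
lemma2 (b ∷ r) (s-normalized , _ , _) _ = upper , lower
  where
  s = b ∷ r
  n = length s
  upper : ∃[ t ] (Reach (ceilDiv (n ∸ 2) 3) s t × Grouped t)
  upper = subst (λ u → ∃[ t ] (Reach (ceilDiv (n ∸ 2) 3) u t × Grouped t))
                (sym (normalized-alt b r s-normalized)) (alt-upper b n)
  lower : ∀ k t → Reach k s t → Grouped t → ceilDiv (n ∸ 2) 3 ≤ k
  lower k _ s↝t t-grouped = ceilDiv-least (n ∸ 2) 2 k (∸-monoˡ-≤ 2 (begin
    n          ≡⟨ blocks-normalized s s-normalized ⟨
    blocks s   ≤⟨ blocks-Reach s↝t t-grouped ⟩
    2 + k * 3  ∎))
    where open ≤-Reasoning
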